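{- A graph is a normal circular-arc graph if and only if it admits an out-round orientation.
   Context: A normal circular-arc graph is the intersection graph of a finite family of open arcs of a circle in which no two arcs together cover the circle. An orientation of a graph $G$ is a digraph $D$ with no pair of opposite directed edges whose underlying graph is isomorphic to $G$. For an ordering $v_1,\dots,v_n$ and indices taken modulo $n$, the circular range $\mathrm{Cir}[v_i,v_j]$ is $v_i,v_{i+1},\dots,v_j$. An oriented graph $D$ is out-round if there is an ordering $v_1,\dots,v_n$ of $V(D)$ such that for every $i$, the closed outset $N^+[v_i]=N^+(v_i)\cup\{v_i\}$ equals $\mathrm{Cir}[v_i,v_{i+r}]$ where $r=d^+(v_i)$ is the outdegree of $v_i$.
   Formalization: The open arcs of a normal circular-arc graph have rational endpoints and lie on the circle taken as ℚ/ℤ, with meeting and covering tested at rational points. -}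

module Defs where

open import Data.Nat using (ℕ; zero; suc; _≤_)
open import Data.Nat.DivMod using (_%_; m%n<n)
open import Data.Fin using (Fin; toℕ; fromℕ<)
open import Data.Bool using (Bool; true; false; if_then_else_)
open import Data.List using (List; map)
open import Data.Nat.ListAction using (sum)
open import Data.Integer using (ℤ; +_)
open import Data.Rational using (ℚ; _<_; _+_; _/_; 0ℚ; 1ℚ) renaming (_≤_ to _≤ℚ_)
open import Data.Product using (Σ; ∃; ∃-syntax; _×_)
open import Data.Sum using (_⊎_)
open import Relation.Nullary using (¬_)
open import Relation.Binary.PropositionalEquality using (_≡_; _≢_)
open import Function.Bundles using (_↔_; _⇔_; Inverse)
import Data.List as L

record Graph : Set where
  field
    n       : ℕ
    adj     : Fin n → Fin n → Bool
    symm    : ∀ u v → adj u v ≡ adj v u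
    irrefl  : ∀ v → adj v v ≡ false
open Graph public

-- Open arcs of the circle ℝ/ℤ, with rational endpoints.
-- The arc with start a and length ℓ (0 < ℓ ≤ 1) is the open set of
-- points x (mod 1) with a < x + k < a + ℓ for some integer k.

record OpenArc : Set where
  field
    start  : ℚ
    len    : ℚ
    len>0  : 0ℚ < len
    len≤1  : len ≤ℚ 1ℚ
open OpenArc public

_∈Arc_ : ℚ → OpenArc → Set
x ∈Arc A = ∃[ k ] ((start A < x + (k / 1)) × (x + (k / 1) < start A + len A))

Meet : OpenArc → OpenArc → Set
Meet A B = ∃[ x ] (x ∈Arc A × x ∈Arc B)

Cover : OpenArc → OpenArc → Set
Cover A B = ∀ (x : ℚ) → x ∈Arc A ⊎ x ∈Arc B

IsNormalCircularArc : Graph → Set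
IsNormalCircularArc G =
  Σ (Fin (n G) → OpenArc) λ arc →
    (∀ u v → u ≢ v → ¬ Cover (arc u) (arc v)) ×
    (∀ u v → u ≢ v → (adj G u v ≡ true ⇔ Meet (arc u) (arc v)))

IsOrientation : (G : Graph) → (Fin (n G) → Fin (n G) → Bool) → Set
IsOrientation G D =
  (∀ u v → D u v ≡ true → adj G u v ≡ true) ×
  (∀ u v → adj G u v ≡ true → (D u v ≡ true ⊎ D v u ≡ true)) ×
  (∀ u v → ¬ (D u v ≡ true × D v u ≡ true))

outdeg : ∀ {m} → (Fin m → Fin m → Bool) → Fin m → ℕ
outdeg {m} D v = sum (map (λ w → if D v w then 1 else 0) (L.allFin m))

shift : ∀ {m} → Fin m → ℕ → Fin m
shift {suc m} i k = fromℕ< (m%n<n (toℕ i ℕ.+ k) (suc m))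
  where import Data.Nat as ℕ

InCir : ∀ {m} → (Fin m → Fin m) → Fin m → ℕ → Fin m → Set
InCir σ i r w = ∃[ k ] (k ≤ r × w ≡ σ (shift i k))

IsOutRound : ∀ {m} → (Fin m → Fin m → Bool) → Set
IsOutRound {m} D =
  Σ (Fin m ↔ Fin m) λ σ →
    ∀ (i : Fin m) (w : Fin m) →
      ((w ≡ Inverse.to σ i ⊎ D (Inverse.to σ i) w ≡ true)
        ⇔ InCir (Inverse.to σ) i (outdeg D (Inverse.to σ i)) w)

HasOutRoundOrientation : Graph → Set
HasOutRoundOrientation G =
  Σ (Fin (n G) → Fin (n G) → Bool) λ D → IsOrientation G D × IsOutRound D

-- Arcs to orientation: orient u → w when the start of w lies in the arc of u (arcs with the same
-- start are ordered by vertex index), and list the vertices by the point of the circle ℝ/ℤ where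
-- their arcs start. Read cyclically from u, this list meets the starts at increasing distance
-- from the start of u, so the closed outset of u, namely the vertices whose start lies less than
-- the length of u's arc ahead of u, is an initial segment; counting identifies it with
-- Cir[u, u + d⁺(u)]. Two arcs meet iff one of them starts inside the other or both start at the
-- same point, and a pair of opposite edges would make the two arcs cover the circle.
--
-- Orientation to arcs: for an out-round ordering of m vertices, give the vertex at position p the
-- arc that starts at p/m and has length (d⁺ + ½)/m. The start of w then lies in the arc of v
-- exactly when w ∈ N⁺[v], so the arcs meet along the edges, and two covering arcs would need a
-- pair of opposite edges.

module Submission where

open import Defs
open import Function.Bundles using (_⇔_; mk⇔; Equivalence)
open import Function.Properties.Equivalence using () renaming (trans to ⇔-trans)
open import Data.Bool using (Bool; true; false)
open import Data.Empty using (⊥-elim)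
open import Data.Fin using (Fin)
open import Data.Nat using (zero; suc)
open import Data.Product using (_×_; _,_)
import Data.Sum as Sum
open import Data.Sum using (_⊎_; inj₂; [_,_]′)
open import Function using (case_of_)
open import Relation.Binary.PropositionalEquality
open import Relation.Nullary using (¬_; Dec; does; yes)
open import Relation.Nullary.Decidable using (dec-true)

does-true⇒ : ∀ {P : Set} (P? : Dec P) → does P? ≡ true → P
does-true⇒ (yes p) _ = p

¬A⇒A⊎B⇔B : ∀ {A B : Set} → ¬ A → (A ⊎ B) ⇔ B
¬A⇒A⊎B⇔B ¬a = mk⇔ [ (λ a → ⊥-elim (¬a a)) , (λ b → b) ]′ inj₂

module Fractions where

  open import Data.Integer as ℤ using (+_; 1ℤ) renaming (_≤_ to _≤ℤ_; _<_ to _<ℤ_)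
  import Data.Integer.Properties as ℤ
  import Data.Integer.DivMod as ℤ
  open import Data.Integer.Solver using (module +-*-Solver)
  open import Data.Nat using (suc)
  open import Data.Rational
  open import Data.Rational.Properties
  import Data.Rational.Unnormalised as ℚᵘ
  import Data.Rational.Unnormalised.Properties as ℚᵘ
  open import Relation.Binary.PropositionalEquality

  open +-*-Solver

  private
    /-toℚᵘ : ∀ N a → toℚᵘ (a / suc N) ℚᵘ.≃ ℚᵘ.mkℚᵘ a N
    /-toℚᵘ N a = toℚᵘ-fromℚᵘ (ℚᵘ.mkℚᵘ a N)

  /-homo-+ : ∀ N a b → (a ℤ.+ b) / suc N ≡ a / suc N + b / suc N
  /-homo-+ N a b = toℚᵘ-injective (begin
      toℚᵘ ((a ℤ.+ b) / suc N)                  ≈⟨ /-toℚᵘ N (a ℤ.+ b) ⟩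
      ℚᵘ.mkℚᵘ (a ℤ.+ b) N                       ≈⟨ ℚᵘ.*≡* cross ⟩
      ℚᵘ.mkℚᵘ a N ℚᵘ.+ ℚᵘ.mkℚᵘ b N              ≈⟨ ℚᵘ.+-cong (ℚᵘ.≃-sym (/-toℚᵘ N a)) (ℚᵘ.≃-sym (/-toℚᵘ N b)) ⟩
      toℚᵘ (a / suc N) ℚᵘ.+ toℚᵘ (b / suc N)    ≈⟨ ℚᵘ.≃-sym (toℚᵘ-homo-+ (a / suc N) (b / suc N)) ⟩
      toℚᵘ (a / suc N + b / suc N)              ∎)
    where
    open ℚᵘ.≃-Reasoning
    d = + suc N
    cross : (a ℤ.+ b) ℤ.* + (suc N Data.Nat.* suc N) ≡ (a ℤ.* d ℤ.+ b ℤ.* d) ℤ.* d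
    cross rewrite sym (ℤ.pos-* (suc N) (suc N)) =
      solve 3 (λ a b d → (a :+ b) :* (d :* d) := (a :* d :+ b :* d) :* d) refl a b d

  /-homo-neg : ∀ N a → (ℤ.- a) / suc N ≡ - (a / suc N)
  /-homo-neg N a = toℚᵘ-injective (begin
      toℚᵘ ((ℤ.- a) / suc N)   ≈⟨ /-toℚᵘ N (ℤ.- a) ⟩
      ℚᵘ.mkℚᵘ (ℤ.- a) N        ≈⟨ ℚᵘ.-‿cong (ℚᵘ.≃-sym (/-toℚᵘ N a)) ⟩
      ℚᵘ.- toℚᵘ (a / suc N)    ≈⟨ ℚᵘ.≃-sym (toℚᵘ-homo‿- (a / suc N)) ⟩
      toℚᵘ (- (a / suc N))     ∎)
    where open ℚᵘ.≃-Reasoning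

  /-mono-≤ : ∀ N {a b} → a ℤ.≤ b → a / suc N ≤ b / suc N
  /-mono-≤ N {a} {b} a≤b = toℚᵘ-cancel-≤
    (ℚᵘ.≤-respʳ-≃ (ℚᵘ.≃-sym (/-toℚᵘ N b)) (ℚᵘ.≤-respˡ-≃ (ℚᵘ.≃-sym (/-toℚᵘ N a))
      (ℚᵘ.*≤* (ℤ.*-monoʳ-≤-nonNeg (+ suc N) a≤b))))

  /-mono-< : ∀ N {a b} → a ℤ.< b → a / suc N < b / suc N
  /-mono-< N {a} {b} a<b = toℚᵘ-cancel-<
    (ℚᵘ.<-respʳ-≃ (ℚᵘ.≃-sym (/-toℚᵘ N b)) (ℚᵘ.<-respˡ-≃ (ℚᵘ.≃-sym (/-toℚᵘ N a))
      (ℚᵘ.*<* (ℤ.*-monoʳ-<-pos (+ suc N) a<b))))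

  /-cancel-< : ∀ N {a b} → a / suc N < b / suc N → a ℤ.< b
  /-cancel-< N {a} {b} a<b
    with ℚᵘ.*<* ad<bd ← ℚᵘ.<-respʳ-≃ (/-toℚᵘ N b) (ℚᵘ.<-respˡ-≃ (/-toℚᵘ N a) (toℚᵘ-mono-< a<b))
    = ℤ.*-cancelʳ-<-nonNeg (+ suc N) ad<bd

  /1-rescale : ∀ N k → k / 1 ≡ (k ℤ.* + suc N) / suc N
  /1-rescale N k = toℚᵘ-injective (begin
      toℚᵘ (k / 1)                       ≈⟨ /-toℚᵘ 0 k ⟩
      ℚᵘ.mkℚᵘ k 0                        ≈⟨ ℚᵘ.*≡* (solve 2 (λ k d → k :* d := (k :* d) :* con (+ 1)) refl k (+ suc N)) ⟩
      ℚᵘ.mkℚᵘ (k ℤ.* + suc N) N          ≈⟨ ℚᵘ.≃-sym (/-toℚᵘ N _) ⟩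
      toℚᵘ ((k ℤ.* + suc N) / suc N)     ∎)
    where open ℚᵘ.≃-Reasoning

  n/n≡1 : ∀ N → + suc N / suc N ≡ 1ℚ
  n/n≡1 N = sym (trans (/1-rescale N 1ℤ) (cong (_/ suc N) (ℤ.*-identityˡ (+ suc N))))

  floor-≤ : ∀ q → floor q / 1 ≤ q
  floor-≤ q@(mkℚ n d _) = toℚᵘ-cancel-≤ (ℚᵘ.≤-respˡ-≃ (ℚᵘ.≃-sym (/-toℚᵘ 0 (floor q))) (ℚᵘ.*≤* fd≤n))
    where
    fd≤n : floor q ℤ.* + suc d ≤ℤ n ℤ.* + 1
    fd≤n = subst₂ ℤ._≤_ (cong (ℤ._* + suc d) (sym (ℤ.div-pos-is-/ℕ n (suc d)))) (sym (ℤ.*-identityʳ n))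
      (ℤ.[n/ℕd]*d≤n n (suc d))

  <-floor+1 : ∀ q → q < (floor q ℤ.+ 1ℤ) / 1
  <-floor+1 q@(mkℚ n d _) = toℚᵘ-cancel-< (ℚᵘ.<-respʳ-≃ (ℚᵘ.≃-sym (/-toℚᵘ 0 (floor q ℤ.+ 1ℤ))) (ℚᵘ.*<* n<[f+1]d))
    where
    [1+n/d]≡f+1 : ℤ.suc (n ℤ./ℕ suc d) ≡ floor q ℤ.+ 1ℤ
    [1+n/d]≡f+1 = trans (ℤ.+-comm 1ℤ (n ℤ./ℕ suc d)) (cong (ℤ._+ 1ℤ) (sym (ℤ.div-pos-is-/ℕ n (suc d))))
    n<[f+1]d : n ℤ.* + 1 <ℤ (floor q ℤ.+ 1ℤ) ℤ.* + suc d
    n<[f+1]d = subst₂ ℤ._<_ (sym (ℤ.*-identityʳ n)) (cong (ℤ._* + suc d) [1+n/d]≡f+1) (ℤ.n<s[n/ℕd]*d n (suc d))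

module CircularDistance where

  open import Data.Empty using (⊥; ⊥-elim)
  open import Data.Integer as ℤ using (ℤ; 0ℤ; 1ℤ)
  open import Data.Nat using (suc; z≤n; s≤s)
  import Data.Nat
  import Data.Integer.Properties as ℤ
  open import Data.Rational
  open import Data.Rational.Properties
  open import Data.Rational.Solver using (module +-*-Solver)
  open import Data.Sum using (_⊎_; inj₁; inj₂)
  import Data.Sum as Sum
  open import Relation.Binary.Definitions using (tri<; tri≈; tri>)
  open import Relation.Binary.PropositionalEquality
  open import Relation.Nullary using (¬_; Dec; yes; no)
  open Fractions

  open +-*-Solver

  private
    no-integer-between : ∀ {q a b} → a ℤ.< b → b / 1 ≤ q → q < (a ℤ.+ 1ℤ) / 1 → ⊥
    no-integer-between {q} {a} {b} a<b b≤q q<a+1 = <-irrefl refl (begin-strict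
        q                <⟨ q<a+1 ⟩
        (a ℤ.+ 1ℤ) / 1   ≤⟨ /-mono-≤ 0 (subst (ℤ._≤ b) (ℤ.+-comm 1ℤ a) (ℤ.i<j⇒suc[i]≤j a<b)) ⟩
        b / 1            ≤⟨ b≤q ⟩
        q                ∎)
      where open ≤-Reasoning

  floor-unique : ∀ {q} k → k / 1 ≤ q → q < (k ℤ.+ 1ℤ) / 1 → floor q ≡ k
  floor-unique {q} k k≤q q<k+1 with ℤ.<-cmp (floor q) k
  ... | tri< f<k _ _ = ⊥-elim (no-integer-between f<k k≤q (<-floor+1 q))
  ... | tri≈ _ f≡k _ = f≡k
  ... | tri> _ _ k<f = ⊥-elim (no-integer-between k<f (floor-≤ q) q<k+1)

  0<1 : 0ℚ < 1ℚ
  0<1 = *<* (ℤ.+<+ (s≤s z≤n))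

  <⇒≱ : ∀ {p q} → p < q → ¬ q ≤ p
  <⇒≱ p<q q≤p = <-irrefl refl (<-≤-trans p<q q≤p)

  frac : ℚ → ℚ
  frac q = q - floor q / 1

  frac-nonneg : ∀ q → 0ℚ ≤ frac q
  frac-nonneg q = begin
      0ℚ                         ≡⟨ sym (+-inverseʳ (floor q / 1)) ⟩
      floor q / 1 - floor q / 1  ≤⟨ +-monoˡ-≤ (- (floor q / 1)) (floor-≤ q) ⟩
      frac q                     ∎
    where open ≤-Reasoning

  frac<1 : ∀ q → frac q < 1ℚ
  frac<1 q = begin-strict
      frac q                     <⟨ +-monoˡ-< (- f) (<-floor+1 q) ⟩
      (floor q ℤ.+ 1ℤ) / 1 - f   ≡⟨ cong (_- f) (/-homo-+ 0 (floor q) 1ℤ) ⟩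
      f + 1ℚ - f                 ≡⟨ solve 1 (λ f → f :+ con 1ℚ :- f := con 1ℚ) refl f ⟩
      1ℚ                         ∎
    where
    open ≤-Reasoning
    f = floor q / 1

  frac-unique : ∀ {q t} k → 0ℚ ≤ t → t < 1ℚ → q ≡ t + k / 1 → frac q ≡ t
  frac-unique {t = t} k 0≤t t<1 refl =
    begin
      t + k / 1 - floor (t + k / 1) / 1  ≡⟨ cong (λ f → t + k / 1 - f / 1) (floor-unique k lower upper) ⟩
      t + k / 1 - k / 1                  ≡⟨ solve 2 (λ t k → t :+ k :- k := t) refl t (k / 1) ⟩
      t                                  ∎
    where
    open ≡-Reasoning
    lower : k / 1 ≤ t + k / 1
    lower = subst (_≤ t + k / 1) (+-identityˡ (k / 1)) (+-monoˡ-≤ (k / 1) 0≤t)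
    upper : t + k / 1 < (k ℤ.+ 1ℤ) / 1
    upper = subst (t + k / 1 <_) (trans (+-comm 1ℚ (k / 1)) (sym (/-homo-+ 0 k 1ℤ))) (+-monoˡ-< (k / 1) t<1)

  frac-+ : ∀ p q → frac (p + q) ≡ frac p + frac q ⊎ frac (p + q) ≡ frac p + frac q - 1ℚ
  frac-+ p q = by-size (s <? 1ℚ)
    where
    open ≡-Reasoning
    P = floor p
    Q = floor q
    s = frac p + frac q
    p+q≡ : p + q ≡ s + (P / 1 + Q / 1)
    p+q≡ = solve 4 (λ p q x y → p :+ q := (p :- x :+ (q :- y)) :+ (x :+ y)) refl p q (P / 1) (Q / 1)
    by-size : Dec (s < 1ℚ) → frac (p + q) ≡ s ⊎ frac (p + q) ≡ s - 1ℚ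
    by-size (yes s<1) = inj₁ (frac-unique (P ℤ.+ Q) (+-mono-≤ (frac-nonneg p) (frac-nonneg q)) s<1 (begin
      p + q                  ≡⟨ p+q≡ ⟩
      s + (P / 1 + Q / 1)    ≡⟨ cong (s +_) (/-homo-+ 0 P Q) ⟨
      s + (P ℤ.+ Q) / 1      ∎))
    by-size (no s≮1) = inj₂ (frac-unique (P ℤ.+ Q ℤ.+ 1ℤ) 0≤s-1 s-1<1 (begin
      p + q                           ≡⟨ p+q≡ ⟩
      s + (P / 1 + Q / 1)             ≡⟨ solve 2 (λ s x → s :+ x := s :- con 1ℚ :+ (x :+ con 1ℚ)) refl s (P / 1 + Q / 1) ⟩
      s - 1ℚ + (P / 1 + Q / 1 + 1ℚ)   ≡⟨ cong (λ x → s - 1ℚ + (x + 1ℚ)) (/-homo-+ 0 P Q) ⟨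
      s - 1ℚ + ((P ℤ.+ Q) / 1 + 1ℚ)   ≡⟨ cong (s - 1ℚ +_) (/-homo-+ 0 (P ℤ.+ Q) 1ℤ) ⟨
      s - 1ℚ + (P ℤ.+ Q ℤ.+ 1ℤ) / 1   ∎))
      where
      0≤s-1 : 0ℚ ≤ s - 1ℚ
      0≤s-1 = subst (_≤ s - 1ℚ) (+-inverseʳ 1ℚ) (+-monoˡ-≤ (- 1ℚ) (≮⇒≥ s≮1))
      s-1<1 : s - 1ℚ < 1ℚ
      s-1<1 = subst (s - 1ℚ <_) (solve 0 (con 1ℚ :+ con 1ℚ :- con 1ℚ := con 1ℚ) refl)
        (+-monoˡ-< (- 1ℚ) (+-mono-< (frac<1 p) (frac<1 q)))

  frac-neg-0 : ∀ q → frac q ≡ 0ℚ → frac (- q) ≡ 0ℚ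
  frac-neg-0 q fq≡0 = frac-unique (ℤ.- floor q) ≤-refl 0<1 (begin
      - q                       ≡⟨ solve 2 (λ q f → :- q := con 0ℚ :+ :- f :- (q :- f)) refl q (floor q / 1) ⟩
      0ℚ + - (floor q / 1) - frac q ≡⟨ cong₂ (λ x y → 0ℚ + x - y) (sym (/-homo-neg 0 (floor q))) fq≡0 ⟩
      0ℚ + (ℤ.- floor q) / 1 - 0ℚ   ≡⟨ solve 1 (λ x → con 0ℚ :+ x :- con 0ℚ := con 0ℚ :+ x) refl ((ℤ.- floor q) / 1) ⟩
      0ℚ + (ℤ.- floor q) / 1        ∎)
    where open ≡-Reasoning

  frac-neg : ∀ q → 0ℚ < frac q → frac (- q) ≡ 1ℚ - frac q
  frac-neg q 0<fq = frac-unique (ℤ.- (floor q ℤ.+ 1ℤ))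
    (subst (_≤ 1ℚ - frac q) (+-inverseʳ (frac q)) (+-monoˡ-≤ (- frac q) (<⇒≤ (frac<1 q))))
    (subst (1ℚ - frac q <_) (+-identityʳ 1ℚ) (+-monoʳ-< 1ℚ (neg-antimono-< 0<fq)))
    (begin
      - q                               ≡⟨ solve 2 (λ q f → :- q := con 1ℚ :- (q :- f) :+ :- (f :+ con 1ℚ)) refl q (floor q / 1) ⟩
      1ℚ - frac q + - (floor q / 1 + 1ℚ)  ≡⟨ cong (λ x → 1ℚ - frac q + - x) (sym (/-homo-+ 0 (floor q) 1ℤ)) ⟩
      1ℚ - frac q + - ((floor q ℤ.+ 1ℤ) / 1)  ≡⟨ cong (1ℚ - frac q +_) (sym (/-homo-neg 0 (floor q ℤ.+ 1ℤ))) ⟩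
      1ℚ - frac q + (ℤ.- (floor q ℤ.+ 1ℤ)) / 1 ∎)
    where open ≡-Reasoning

  δ : ℚ → ℚ → ℚ
  δ a x = frac (x - a)

  δ-nonneg : ∀ a x → 0ℚ ≤ δ a x
  δ-nonneg a x = frac-nonneg (x - a)

  δ<1 : ∀ a x → δ a x < 1ℚ
  δ<1 a x = frac<1 (x - a)

  δ-self : ∀ a → δ a a ≡ 0ℚ
  δ-self a = frac-unique 0ℤ ≤-refl 0<1 (trans (+-inverseʳ a) (sym (+-identityʳ 0ℚ)))

  δ-+ : ∀ a b x → δ a x ≡ δ a b + δ b x ⊎ δ a x ≡ δ a b + δ b x - 1ℚ
  δ-+ a b x = subst (λ y → frac y ≡ δ a b + δ b x ⊎ frac y ≡ δ a b + δ b x - 1ℚ)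
    (solve 3 (λ a b x → (b :- a) :+ (x :- b) := x :- a) refl a b x) (frac-+ (b - a) (x - b))

  δ-+-< : ∀ a b x → δ a b + δ b x < 1ℚ → δ a x ≡ δ a b + δ b x
  δ-+-< a b x s<1 = Sum.[ (λ δax≡s → δax≡s) , (λ δax≡s-1 → ⊥-elim (<-irrefl refl (≤-<-trans (δ-nonneg a x)
    (subst (_< 0ℚ) (sym δax≡s-1) (subst (δ a b + δ b x - 1ℚ <_) (+-inverseʳ 1ℚ) (+-monoˡ-< (- 1ℚ) s<1)))))) ]′ (δ-+ a b x)

  private
    a-b≡-[b-a] : ∀ a b → a - b ≡ - (b - a)
    a-b≡-[b-a] a b = solve 2 (λ a b → a :- b := :- (b :- a)) refl a b

  δ-reverse-0 : ∀ a b → δ a b ≡ 0ℚ → δ b a ≡ 0ℚ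
  δ-reverse-0 a b δab≡0 = subst (λ y → frac y ≡ 0ℚ) (sym (a-b≡-[b-a] a b)) (frac-neg-0 (b - a) δab≡0)

  δ-reverse : ∀ a b → 0ℚ < δ a b → δ b a ≡ 1ℚ - δ a b
  δ-reverse a b 0<δab = subst (λ y → frac y ≡ 1ℚ - δ a b) (sym (a-b≡-[b-a] a b)) (frac-neg (b - a) 0<δab)

  δ-grid : ∀ N {a b : ℤ} {c} t → c Data.Nat.< suc N → b ℤ.- a ≡ ℤ.+ c ℤ.+ t ℤ.* ℤ.+ suc N →
           δ (a / suc N) (b / suc N) ≡ ℤ.+ c / suc N
  δ-grid N {a} {b} {c} t c<n b-a≡ = frac-unique t
    (subst (_≤ ℤ.+ c / suc N) (0/n≡0 (suc N)) (/-mono-≤ N {0ℤ} {ℤ.+ c} (ℤ.+≤+ z≤n)))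
    (subst (ℤ.+ c / suc N <_) (n/n≡1 N) (/-mono-< N (ℤ.+<+ c<n)))
    (begin
      b / suc N - a / suc N                   ≡⟨ cong (b / suc N +_) (sym (/-homo-neg N a)) ⟩
      b / suc N + (ℤ.- a) / suc N             ≡⟨ sym (/-homo-+ N b (ℤ.- a)) ⟩
      (b ℤ.- a) / suc N                       ≡⟨ cong (_/ suc N) b-a≡ ⟩
      (ℤ.+ c ℤ.+ t ℤ.* ℤ.+ suc N) / suc N         ≡⟨ /-homo-+ N (ℤ.+ c) (t ℤ.* ℤ.+ suc N) ⟩
      ℤ.+ c / suc N + (t ℤ.* ℤ.+ suc N) / suc N   ≡⟨ cong (ℤ.+ c / suc N +_) (sym (/1-rescale N t)) ⟩
      ℤ.+ c / suc N + t / 1                     ∎)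
    where open ≡-Reasoning

module ArcGeometry where

  open import Data.Empty using (⊥; ⊥-elim)
  open import Data.Integer as ℤ using (ℤ; 0ℤ)
  open import Data.Product using (_×_; _,_; proj₁; proj₂; ∃-syntax)
  open import Data.Rational
  open import Data.Rational.Properties
  open import Data.Rational.Solver using (module +-*-Solver)
  open import Data.Sum using (_⊎_; inj₁; inj₂)
  import Data.Sum as Sum
  open import Relation.Binary.PropositionalEquality
  open import Relation.Nullary using (¬_; Dec; yes; no)
  open Fractions
  open CircularDistance

  open +-*-Solver

  <-+-pos : ∀ p {u} → 0ℚ < u → p < p + u
  <-+-pos p 0<u = subst (_< p + _) (+-identityʳ p) (+-monoʳ-< p 0<u)

  <⇒0<- : ∀ {p q} → p < q → 0ℚ < q - p
  <⇒0<- {p} {q} p<q = subst (_< q - p) (+-inverseʳ p) (+-monoˡ-< (- p) p<q)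

  ∈Arc⇒ : ∀ x A → x ∈Arc A → 0ℚ < δ (start A) x × δ (start A) x < len A
  ∈Arc⇒ x A (k , a<y , y<a+ℓ) = subst (λ d → 0ℚ < d × d < len A) (sym δ≡t) (0<t , t<ℓ)
    where
    a = start A
    t = x + k / 1 - a
    0<t : 0ℚ < t
    0<t = <⇒0<- a<y
    t<ℓ : t < len A
    t<ℓ = subst (t <_) (solve 2 (λ a ℓ → a :+ ℓ :- a := ℓ) refl a (len A)) (+-monoˡ-< (- a) y<a+ℓ)
    δ≡t : δ a x ≡ t
    δ≡t = frac-unique (ℤ.- k) (<⇒≤ 0<t) (<-≤-trans t<ℓ (len≤1 A)) (begin
        x - a                    ≡⟨ solve 3 (λ x a j → x :- a := x :+ j :- a :+ :- j) refl x a (k / 1) ⟩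
        t + - (k / 1)            ≡⟨ cong (t +_) (sym (/-homo-neg 0 k)) ⟩
        t + (ℤ.- k) / 1          ∎)
      where open ≡-Reasoning

  ∈Arc⇐ : ∀ x A → 0ℚ < δ (start A) x → δ (start A) x < len A → x ∈Arc A
  ∈Arc⇐ x A 0<d d<ℓ = ℤ.- floor (x - a) , subst (a <_) a+d≡y (<-+-pos a 0<d) , subst (_< a + len A) a+d≡y (+-monoʳ-< a d<ℓ)
    where
    a = start A
    a+d≡y : a + δ a x ≡ x + (ℤ.- floor (x - a)) / 1
    a+d≡y = begin
        a + (x - a - floor (x - a) / 1)    ≡⟨ solve 3 (λ a x f → a :+ (x :- a :- f) := x :+ :- f) refl a x (floor (x - a) / 1) ⟩
        x + - (floor (x - a) / 1)          ≡⟨ cong (x +_) (sym (/-homo-neg 0 (floor (x - a)))) ⟩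
        x + (ℤ.- floor (x - a)) / 1        ∎
      where open ≡-Reasoning

  private
    two-wraps-impossible : ∀ {p q t u} → p < 1ℚ → q < 1ℚ →
      t ≡ p + u - 1ℚ → u ≡ q + t - 1ℚ → ⊥
    two-wraps-impossible {p} {q} {t} {u} p<1 q<1 t≡ u≡ = <-irrefl p+q≡2 (+-mono-< p<1 q<1)
      where
      open ≡-Reasoning
      p+q≡2 : p + q ≡ 1ℚ + 1ℚ
      p+q≡2 = begin
        p + q
          ≡⟨ solve 4 (λ p q t u → p :+ q := (p :+ u :- con 1ℚ) :+ (q :+ t :- con 1ℚ) :- (t :+ u) :+ (con 1ℚ :+ con 1ℚ)) refl p q t u ⟩
        p + u - 1ℚ + (q + t - 1ℚ) - (t + u) + (1ℚ + 1ℚ)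
          ≡⟨ cong₂ (λ t′ u′ → t′ + u′ - (t + u) + (1ℚ + 1ℚ)) (sym t≡) (sym u≡) ⟩
        t + u - (t + u) + (1ℚ + 1ℚ)
          ≡⟨ solve 2 (λ t u → t :+ u :- (t :+ u) :+ (con 1ℚ :+ con 1ℚ) := con 1ℚ :+ con 1ℚ) refl t u ⟩
        1ℚ + 1ℚ
          ∎

  Meet-sym : ∀ A B → Meet A B → Meet B A
  Meet-sym A B (x , x∈A , x∈B) = x , x∈B , x∈A

  meet⇒ : ∀ A B → Meet A B → δ (start A) (start B) < len A ⊎ δ (start B) (start A) < len B
  meet⇒ A B (x , x∈A , x∈B) = cases (δ-+ a b x) (δ-+ b a x)
    where
    a = start A
    b = start B
    t = δ a x
    u = δ b x
    cases : t ≡ δ a b + u ⊎ t ≡ δ a b + u - 1ℚ → u ≡ δ b a + t ⊎ u ≡ δ b a + t - 1ℚ →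
            δ a b < len A ⊎ δ b a < len B
    cases (inj₁ t≡p+u) _ =
      inj₁ (<-trans (subst (δ a b <_) (sym t≡p+u) (<-+-pos (δ a b) (proj₁ (∈Arc⇒ x B x∈B)))) (proj₂ (∈Arc⇒ x A x∈A)))
    cases (inj₂ _) (inj₁ u≡q+t) =
      inj₂ (<-trans (subst (δ b a <_) (sym u≡q+t) (<-+-pos (δ b a) (proj₁ (∈Arc⇒ x A x∈A)))) (proj₂ (∈Arc⇒ x B x∈B)))
    cases (inj₂ t≡p+u-1) (inj₂ u≡q+t-1) =
      ⊥-elim (two-wraps-impossible (δ<1 a b) (δ<1 b a) t≡p+u-1 u≡q+t-1)

  private
    ⊓-pos : ∀ {r s} → 0ℚ < r → 0ℚ < s → 0ℚ < r ⊓ s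
    ⊓-pos {r} {s} 0<r 0<s = Sum.[ (λ e → subst (0ℚ <_) (sym e) 0<r) , (λ e → subst (0ℚ <_) (sym e) 0<s) ]′ (⊓-sel r s)

    positive-below : ∀ {r s} → 0ℚ < r → 0ℚ < s → ∃[ ε ] (0ℚ < ε × ε < r × ε < s)
    positive-below {r} {s} 0<r 0<s with ε , 0<ε , ε<r⊓s ← <-dense (⊓-pos 0<r 0<s) =
      ε , 0<ε , <-≤-trans ε<r⊓s (p⊓q≤p r s) , <-≤-trans ε<r⊓s (p⊓q≤q r s)

  meet⇐ : ∀ A B → δ (start A) (start B) < len A → Meet A B
  meet⇐ A B p<ℓA = meet-after-start (positive-below (<⇒0<- p<ℓA) (len>0 B))
    where
    a = start A
    b = start B
    p = δ a b
    meet-after-start : ∃[ ε ] (0ℚ < ε × ε < len A - p × ε < len B) → Meet A B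
    meet-after-start (ε , 0<ε , ε<ℓA-p , ε<ℓB) =
      x , ∈Arc⇐ x A (subst (0ℚ <_) (sym δax≡p+ε) 0<p+ε) (subst (_< len A) (sym δax≡p+ε) p+ε<ℓA)
        , ∈Arc⇐ x B (subst (0ℚ <_) (sym δbx≡ε) 0<ε) (subst (_< len B) (sym δbx≡ε) ε<ℓB)
      where
      x = b + ε
      δbx≡ε : δ b x ≡ ε
      δbx≡ε = frac-unique 0ℤ (<⇒≤ 0<ε) (<-≤-trans ε<ℓB (len≤1 B)) (solve 2 (λ b ε → b :+ ε :- b := ε :+ con 0ℚ) refl b ε)
      0<p+ε : 0ℚ < p + ε
      0<p+ε = ≤-<-trans (δ-nonneg a b) (<-+-pos p 0<ε)
      p+ε<ℓA : p + ε < len A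
      p+ε<ℓA = subst (p + ε <_) (solve 2 (λ p ℓ → p :+ (ℓ :- p) := ℓ) refl p (len A)) (+-monoʳ-< p ε<ℓA-p)
      δax≡p+ε : δ a x ≡ p + ε
      δax≡p+ε = trans (δ-+-< a b x (subst (λ e → p + e < 1ℚ) (sym δbx≡ε) (<-≤-trans p+ε<ℓA (len≤1 A)))) (cong (p +_) δbx≡ε)

  cover⇒start∈ : ∀ A B → Cover A B → start B ∈Arc A
  cover⇒start∈ A B cover = Sum.[ (λ b∈A → b∈A) , (λ b∈B → ⊥-elim (b∉B b∈B)) ]′ (cover (start B))
    where
    b∉B : ¬ start B ∈Arc B
    b∉B b∈B = <-irrefl (sym (δ-self (start B))) (proj₁ (∈Arc⇒ (start B) B b∈B))

  cover⇐ : ∀ A B → 0ℚ < δ (start A) (start B) → δ (start A) (start B) < len A →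
           δ (start B) (start A) < len B → Cover A B
  cover⇐ A B 0<p p<ℓA q<ℓB x = by-position (δ a x <? len A) (0ℚ <? δ a x)
    where
    a = start A
    b = start B
    p = δ a b
    q = δ b a
    t = δ a x
    u = δ b x
    q≡1-p : q ≡ 1ℚ - p
    q≡1-p = δ-reverse a b 0<p
    in-B : 0ℚ < u → u < len B → x ∈Arc A ⊎ x ∈Arc B
    in-B 0<u u<ℓB = inj₂ (∈Arc⇐ x B 0<u u<ℓB)
    at-start : t ≡ 0ℚ → u ≡ q
    at-start t≡0 = begin
      u       ≡⟨ δ-+-< b a x (subst (λ t′ → q + t′ < 1ℚ) (sym t≡0) (subst (_< 1ℚ) (sym (+-identityʳ q)) (δ<1 b a))) ⟩
      q + t   ≡⟨ cong (q +_) t≡0 ⟩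
      q + 0ℚ  ≡⟨ +-identityʳ q ⟩
      q       ∎
      where open ≡-Reasoning
    beyond : p < t → u ≡ t - p
    beyond p<t = Sum.[ (λ u≡q+t → ⊥-elim (<-asym (δ<1 b x) (subst (1ℚ <_) (sym u≡q+t) 1<q+t))) , unwrap ]′ (δ-+ b a x)
      where
      1<q+t : 1ℚ < q + t
      1<q+t = subst₂ _<_ (solve 1 (λ p → con 1ℚ :- p :+ p := con 1ℚ) refl p) (cong (_+ t) (sym q≡1-p)) (+-monoʳ-< (1ℚ - p) p<t)
      unwrap : u ≡ q + t - 1ℚ → u ≡ t - p
      unwrap u≡q+t-1 = trans u≡q+t-1 (trans (cong (λ q′ → q′ + t - 1ℚ) q≡1-p)
        (solve 2 (λ p t → con 1ℚ :- p :+ t :- con 1ℚ := t :- p) refl p t))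
    by-position : Dec (t < len A) → Dec (0ℚ < t) → x ∈Arc A ⊎ x ∈Arc B
    by-position (yes t<ℓA) (yes 0<t) = inj₁ (∈Arc⇐ x A 0<t t<ℓA)
    by-position (yes t<ℓA) (no 0≮t) = in-B (subst (0ℚ <_) (sym u≡q) 0<q) (subst (_< len B) (sym u≡q) q<ℓB)
      where
      u≡q = at-start (≤-antisym (≮⇒≥ 0≮t) (δ-nonneg a x))
      0<q = subst (0ℚ <_) (sym q≡1-p) (<⇒0<- (δ<1 a b))
    by-position (no t≮ℓA) _ = in-B (subst (0ℚ <_) (sym u≡t-p) (<⇒0<- p<t)) (subst (_< len B) (sym u≡t-p) t-p<ℓB)
      where
      p<t = <-≤-trans p<ℓA (≮⇒≥ t≮ℓA)
      u≡t-p = beyond p<t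
      t-p<ℓB : t - p < len B
      t-p<ℓB = <-trans (subst (t - p <_) (sym q≡1-p) (+-monoˡ-< (- p) (δ<1 a x))) q<ℓB

module Counting where

  open import Data.Bool using (Bool; true; false; if_then_else_; _∨_)
  open import Data.Fin using (Fin; zero; suc; toℕ; _≟_)
  open import Data.List using (tabulate)
  open import Data.List.Properties using (map-tabulate)
  open import Data.Nat using (ℕ; zero; suc; _+_; _≤_; _<_; z≤n; s≤s; s≤s⁻¹)
  open import Data.Nat.ListAction as List using ()
  open import Data.Nat.Properties using (+-mono-≤; +-mono-≤-<; +-0-commutativeMonoid)
  open import Function using (_∘_; _↔_; Inverse)
  open import Function.Bundles using (_⇔_; mk⇔; Equivalence)
  open import Relation.Nullary.Negation using (contradiction)
  open import Relation.Binary.PropositionalEquality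
  open import Relation.Nullary using (does; yes; no)
  open import Algebra.Properties.CommutativeMonoid.Sum +-0-commutativeMonoid
    using (sum; sum-cong-≗; ∑-distrib-+; ∑-permute)

  indicator : Bool → ℕ
  indicator b = if b then 1 else 0

  count : ∀ {m} → (Fin m → Bool) → ℕ
  count p = sum (indicator ∘ p)

  sum-tabulate : ∀ {m} (f : Fin m → ℕ) → List.sum (tabulate f) ≡ sum f
  sum-tabulate {zero} f = refl
  sum-tabulate {suc m} f = cong (f zero +_) (sum-tabulate (f ∘ suc))

  outdeg≡count : ∀ {m} (D : Fin m → Fin m → Bool) v → outdeg D v ≡ count (D v)
  outdeg≡count {m} D v = trans (cong List.sum (map-tabulate (λ w → w) (indicator ∘ D v))) (sum-tabulate (indicator ∘ D v))

  count-permute : ∀ {m} (p : Fin m → Bool) (π : Fin m ↔ Fin m) → count p ≡ count (p ∘ Inverse.to π)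
  count-permute p π = ∑-permute (indicator ∘ p) π

  indicator-mono : ∀ {a b} → (a ≡ true → b ≡ true) → indicator a ≤ indicator b
  indicator-mono {false} _ = z≤n
  indicator-mono {true} a⇒b rewrite a⇒b refl = s≤s z≤n

  count-mono : ∀ {m} {p q : Fin m → Bool} → (∀ w → p w ≡ true → q w ≡ true) → count p ≤ count q
  count-mono {zero} _ = z≤n
  count-mono {suc m} p⇒q = +-mono-≤ (indicator-mono (p⇒q zero)) (count-mono (p⇒q ∘ suc))

  count-mono-< : ∀ {m} {p q : Fin m → Bool} → (∀ w → p w ≡ true → q w ≡ true) →
                 ∀ j → p j ≡ false → q j ≡ true → count p < count q
  count-mono-< {suc m} {p} {q} p⇒q zero pj≡false qj≡true
    rewrite pj≡false | qj≡true = s≤s (count-mono (p⇒q ∘ suc))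
  count-mono-< {suc m} p⇒q (suc j) pj≡false qj≡true =
    +-mono-≤-< (indicator-mono (p⇒q zero)) (count-mono-< (p⇒q ∘ suc) j pj≡false qj≡true)

  count-all : ∀ m → count {m} (λ _ → true) ≡ m
  count-all zero = refl
  count-all (suc m) = cong suc (count-all m)

  count<size : ∀ {m} (p : Fin m → Bool) j → p j ≡ false → count p < m
  count<size {m} p j pj≡false = subst (count p <_) (count-all m) (count-mono-< (λ _ _ → refl) j pj≡false refl)

  count-none : ∀ {m} {p : Fin m → Bool} → (∀ w → p w ≡ false) → count p ≡ 0
  count-none {zero} _ = refl
  count-none {suc m} p≡false rewrite p≡false zero = count-none (p≡false ∘ suc)

  count-≟ : ∀ {m} (u : Fin m) → count (λ w → does (w ≟ u)) ≡ 1
  count-≟ {suc m} zero = cong suc (count-none {m} {λ w → does (suc w ≟ zero)} (λ _ → refl))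
  count-≟ {suc m} (suc u) = trans (sum-cong-≗ shifted) (count-≟ u)
    where
    shifted : ∀ w → indicator (does (suc w ≟ suc u)) ≡ indicator (does (w ≟ u))
    shifted w with w ≟ u
    ... | yes refl = refl
    ... | no w≢u = refl

  count-insert : ∀ {m} (p : Fin m → Bool) u → p u ≡ false → count (λ w → does (w ≟ u) ∨ p w) ≡ suc (count p)
  count-insert p u pu≡false = begin
      count (λ w → does (w ≟ u) ∨ p w)                          ≡⟨ sum-cong-≗ split ⟩
      sum (λ w → indicator (does (w ≟ u)) + indicator (p w))    ≡⟨ ∑-distrib-+ (λ w → indicator (does (w ≟ u))) (indicator ∘ p) ⟩
      count (λ w → does (w ≟ u)) + count p                      ≡⟨ cong (_+ count p) (count-≟ u) ⟩
      suc (count p)                                             ∎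
    where
    open ≡-Reasoning
    split : ∀ w → indicator (does (w ≟ u) ∨ p w) ≡ indicator (does (w ≟ u)) + indicator (p w)
    split w with w ≟ u
    ... | yes refl rewrite pu≡false = refl
    ... | no _ = refl

  DownClosed : ∀ {m} → (Fin m → Bool) → Set
  DownClosed p = ∀ {j k} → toℕ j ≤ toℕ k → p k ≡ true → p j ≡ true

  downClosed⇒initialSegment : ∀ {m} {p : Fin m → Bool} → DownClosed p → ∀ k → p k ≡ true ⇔ toℕ k < count p
  downClosed⇒initialSegment {suc m} {p} closed k with p zero in p0≡
  ... | false = mk⇔ (λ pk≡true → contradiction (trans (sym p0≡) (closed z≤n pk≡true)) λ ())
                    (λ k<0 → contradiction (subst (toℕ k <_) (count-none none) k<0) λ ())
    where
    none : ∀ w → p (suc w) ≡ false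
    none w with p (suc w) in psw≡
    ... | false = refl
    ... | true = trans (sym (closed z≤n psw≡)) p0≡
  ... | true = inSegment k
    where
    inSegment : ∀ k → p k ≡ true ⇔ toℕ k < suc (count (p ∘ suc))
    inSegment zero = mk⇔ (λ _ → s≤s z≤n) (λ _ → p0≡)
    inSegment (suc k) = mk⇔ (s≤s ∘ Equivalence.to rest) (Equivalence.from rest ∘ s≤s⁻¹)
      where rest = downClosed⇒initialSegment (λ j≤k → closed (s≤s j≤k)) k

  outdeg<size : ∀ {m} (D : Fin m → Fin m → Bool) v → D v v ≡ false → outdeg D v < m
  outdeg<size D v Dvv≡false = subst (_< _) (sym (outdeg≡count D v)) (count<size (D v) v Dvv≡false)

module CyclicOffset where

  open import Data.Empty using (⊥-elim)
  open import Data.Fin using (Fin; toℕ)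
  open import Data.Fin.Properties using (toℕ<n; toℕ-fromℕ<; toℕ-injective)
  open import Data.Nat
  open import Data.Nat.DivMod using (m%n<n; m<n⇒m%n≡m; [m+n]%n≡m%n)
  open import Data.Nat.Properties
  open import Data.Sum using (_⊎_; inj₁; inj₂)
  open import Relation.Binary.PropositionalEquality
  open import Relation.Nullary using (yes; no)

  Lands : ∀ {m} → Fin m → ℕ → Fin m → Set
  Lands {m} i a j = toℕ i + a ≡ toℕ j ⊎ toℕ i + a ≡ toℕ j + m

  lands-unique : ∀ {m} (i j : Fin m) {a b} → a < m → b < m → Lands i a j → Lands i b j → a ≡ b
  lands-unique {m} i j {a} {b} a<m b<m = cases
    where
    lapped : ∀ {a b} → toℕ i + a ≡ toℕ j → toℕ i + b ≡ toℕ j + m → m ≤ b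
    lapped {a} {b} ea eb = subst (m ≤_) (sym b≡a+m) (m≤n+m m a)
      where
      b≡a+m : b ≡ a + m
      b≡a+m = +-cancelˡ-≡ (toℕ i) b (a + m) (trans eb (trans (cong (_+ m) (sym ea)) (+-assoc (toℕ i) a m)))
    cases : Lands i a j → Lands i b j → a ≡ b
    cases (inj₁ ea) (inj₁ eb) = +-cancelˡ-≡ (toℕ i) a b (trans ea (sym eb))
    cases (inj₂ ea) (inj₂ eb) = +-cancelˡ-≡ (toℕ i) a b (trans ea (sym eb))
    cases (inj₁ ea) (inj₂ eb) = ⊥-elim (<⇒≱ b<m (lapped ea eb))
    cases (inj₂ ea) (inj₁ eb) = ⊥-elim (<⇒≱ a<m (lapped eb ea))

  toℕ-shift : ∀ {m} (i : Fin (suc m)) k → toℕ (shift i k) ≡ (toℕ i + k) % suc m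
  toℕ-shift {m} i k = toℕ-fromℕ< (m%n<n (toℕ i + k) (suc m))

  shift-lands : ∀ {m} (i : Fin m) k → k < m → Lands i k (shift i k)
  shift-lands {suc m} i k k<m with toℕ i + k <? suc m
  ... | yes i+k<m = inj₁ (sym (trans (toℕ-shift i k) (m<n⇒m%n≡m i+k<m)))
  ... | no i+k≮m = inj₂ (begin
      toℕ i + k                        ≡⟨ m∸n+n≡m m≤i+k ⟨
      toℕ i + k ∸ suc m + suc m        ≡⟨ cong (_+ suc m) reduced ⟨
      toℕ (shift i k) + suc m          ∎)
    where
    open ≡-Reasoning
    m≤i+k = ≮⇒≥ i+k≮m
    wrapped<m : toℕ i + k ∸ suc m < suc m
    wrapped<m = +-cancelʳ-< (suc m) _ _ (subst (_< suc m + suc m) (sym (m∸n+n≡m m≤i+k)) (+-mono-< (toℕ<n i) k<m))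
    reduced : toℕ (shift i k) ≡ toℕ i + k ∸ suc m
    reduced = begin
      toℕ (shift i k)                            ≡⟨ toℕ-shift i k ⟩
      (toℕ i + k) % suc m                        ≡⟨ cong (_% suc m) (m∸n+n≡m m≤i+k) ⟨
      (toℕ i + k ∸ suc m + suc m) % suc m        ≡⟨ [m+n]%n≡m%n (toℕ i + k ∸ suc m) (suc m) ⟩
      (toℕ i + k ∸ suc m) % suc m                ≡⟨ m<n⇒m%n≡m wrapped<m ⟩
      toℕ i + k ∸ suc m                          ∎

  toℕ≤+size : ∀ {m} (i : Fin m) n → toℕ i ≤ n + m
  toℕ≤+size {m} i n = ≤-trans (<⇒≤ (toℕ<n i)) (m≤n+m m n)

  offset : ∀ {m} → Fin m → Fin m → ℕ
  offset {m} i j with toℕ i ≤? toℕ j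
  ... | yes _ = toℕ j ∸ toℕ i
  ... | no _ = toℕ j + m ∸ toℕ i

  offset-lands : ∀ {m} (i j : Fin m) → Lands i (offset i j) j
  offset-lands {m} i j with toℕ i ≤? toℕ j
  ... | yes i≤j = inj₁ (m+[n∸m]≡n i≤j)
  ... | no _ = inj₂ (m+[n∸m]≡n (toℕ≤+size i (toℕ j)))

  offset<size : ∀ {m} (i j : Fin m) → offset i j < m
  offset<size {m} i j with toℕ i ≤? toℕ j
  ... | yes _ = ≤-<-trans (m∸n≤m (toℕ j) (toℕ i)) (toℕ<n j)
  ... | no i≰j = +-cancelˡ-< (toℕ i) _ _ (begin-strict
      toℕ i + (toℕ j + m ∸ toℕ i)   ≡⟨ m+[n∸m]≡n (toℕ≤+size i (toℕ j)) ⟩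
      toℕ j + m                     <⟨ +-monoˡ-< m (≰⇒> i≰j) ⟩
      toℕ i + m                     ∎)
    where open ≤-Reasoning

  offset-shift : ∀ {m} (i : Fin m) k → k < m → offset i (shift i k) ≡ k
  offset-shift i k k<m = lands-unique i (shift i k) (offset<size i (shift i k)) k<m (offset-lands i (shift i k)) (shift-lands i k k<m)

  shift-offset : ∀ {m} (i j : Fin m) → shift i (offset i j) ≡ j
  shift-offset {suc m} i j = toℕ-injective (trans (toℕ-shift i (offset i j)) (reduce (offset-lands i j)))
    where
    reduce : Lands i (offset i j) j → (toℕ i + offset i j) % suc m ≡ toℕ j
    reduce (inj₁ e) = trans (cong (_% suc m) e) (m<n⇒m%n≡m (toℕ<n j))
    reduce (inj₂ e) = trans (cong (_% suc m) e) (trans ([m+n]%n≡m%n (toℕ j) (suc m)) (m<n⇒m%n≡m (toℕ<n j)))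

module Unwinding where

  open import Data.Empty using (⊥-elim)
  open import Data.Fin using (Fin; toℕ)
  open import Data.Fin.Properties using (toℕ<n)
  import Data.Nat as ℕ
  import Data.Nat.Properties as ℕ
  open import Data.Rational
  open import Data.Rational.Properties
  open import Relation.Binary.PropositionalEquality
  open import Relation.Nullary using (yes; no)
  open import Data.Product using (_×_; _,_)
  open import Data.Sum using (_⊎_; inj₁; inj₂)
  open CyclicOffset

  -- g read around the cycle starting at i: the positions before i are reached after a full turn
  unwound : ∀ {m} → (Fin m → ℚ) → Fin m → Fin m → ℚ
  unwound g i j with toℕ i ℕ.≤? toℕ j
  ... | yes _ = g j
  ... | no _ = g j + 1ℚ

  private
    ∸-cancelʳ-≤′ : ∀ {a b c} → a ℕ.≤ b → a ℕ.≤ c → b ℕ.∸ a ℕ.≤ c ℕ.∸ a → b ℕ.≤ c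
    ∸-cancelʳ-≤′ {a} a≤b a≤c b-a≤c-a =
      subst₂ ℕ._≤_ (ℕ.m+[n∸m]≡n a≤b) (ℕ.m+[n∸m]≡n a≤c) (ℕ.+-monoʳ-≤ a b-a≤c-a)

  unwound-mono : ∀ {m} (g : Fin m → ℚ) → (∀ {j j′} → toℕ j ℕ.≤ toℕ j′ → g j ≤ g j′) →
                 (∀ j → 0ℚ ≤ g j) → (∀ j → g j < 1ℚ) →
                 ∀ i {j j′} → offset i j ℕ.≤ offset i j′ → unwound g i j ≤ unwound g i j′
  unwound-mono {m} g g-mono g≥0 g<1 i {j} {j′} o≤o′ with toℕ i ℕ.≤? toℕ j | toℕ i ℕ.≤? toℕ j′
  ... | yes i≤j | yes i≤j′ = g-mono (∸-cancelʳ-≤′ i≤j i≤j′ o≤o′)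
  ... | no _ | no _ =
    +-monoˡ-≤ 1ℚ (g-mono (ℕ.+-cancelʳ-≤ m _ _ (∸-cancelʳ-≤′ (toℕ≤+size i (toℕ j)) (toℕ≤+size i (toℕ j′)) o≤o′)))
  ... | yes _ | no _ = <⇒≤ (<-≤-trans (g<1 j) (subst (_≤ g j′ + 1ℚ) (+-identityˡ 1ℚ) (+-monoˡ-≤ 1ℚ (g≥0 j′))))
  ... | no _ | yes i≤j′ = ⊥-elim (ℕ.<-irrefl refl (ℕ.<-≤-trans (toℕ<n j′) (ℕ.≤-trans (ℕ.m≤n+m m (toℕ j))
        (∸-cancelʳ-≤′ (toℕ≤+size i (toℕ j)) i≤j′ o≤o′))))

  unwound-cases : ∀ {m} (g : Fin m → ℚ) i j →
    (unwound g i j ≡ g j × toℕ i ℕ.≤ toℕ j) ⊎ (unwound g i j ≡ g j + 1ℚ × toℕ j ℕ.< toℕ i)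
  unwound-cases g i j with toℕ i ℕ.≤? toℕ j
  ... | yes i≤j = inj₁ (refl , i≤j)
  ... | no i≰j = inj₂ (refl , ℕ.≰⇒> i≰j)

module FiniteOrder where

  open import Data.Empty using (⊥-elim)
  open import Data.Fin using (Fin; suc; toℕ; fromℕ<; punchOut; _<_; _≟_)
  open import Data.Fin.Properties using (any?; punchOut-injective; injective⇒≤; toℕ-fromℕ<)
  import Data.Nat as ℕ
  import Data.Nat.Properties as ℕ
  open import Data.Product using (_,_; ∃-syntax; proj₁; proj₂)
  open import Function using (_↔_; mk↔ₛ′)
  open import Function.Bundles using (_⇔_; mk⇔)
  open import Function.Definitions using (Injective)
  open import Level using (0ℓ)
  open import Relation.Binary using (Rel; Transitive; Trichotomous; tri<; tri≈; tri>)
  open import Relation.Binary.Consequences using (tri⇒dec<; tri⇒irr)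
  open import Relation.Binary.PropositionalEquality
  open import Relation.Nullary using (does; yes; no)
  open import Relation.Nullary.Decidable using (dec-true; dec-false)
  open Counting

  injective⇒surjective : ∀ {m} {f : Fin m → Fin m} → Injective _≡_ _≡_ f → ∀ y → ∃[ x ] f x ≡ y
  injective⇒surjective {ℕ.suc m} {f} f-inj y with any? (λ x → f x ≟ y)
  ... | yes hit = hit
  ... | no miss = ⊥-elim (ℕ.<-irrefl refl (injective⇒≤ {f = skip} skip-injective))
    where
    y≢f : ∀ x → y ≢ f x
    y≢f x y≡fx = miss (x , sym y≡fx)
    skip : Fin (ℕ.suc m) → Fin m
    skip x = punchOut (y≢f x)
    skip-injective : Injective _≡_ _≡_ skip
    skip-injective e = f-inj (punchOut-injective (y≢f _) (y≢f _) e)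

  module Ranking {m} {_≺_ : Rel (Fin m) 0ℓ} (≺-trans : Transitive _≺_) (compare : Trichotomous _≡_ _≺_) where

    _≺?_ = tri⇒dec< compare

    rank : Fin m → ℕ.ℕ
    rank u = count (λ w → does (w ≺? u))

    rank<size : ∀ u → rank u ℕ.< m
    rank<size u = count<size _ u (dec-false (u ≺? u) (tri⇒irr compare refl))

    rank-mono : ∀ {u v} → u ≺ v → rank u ℕ.< rank v
    rank-mono {u} {v} u≺v = count-mono-<
      (λ w w≺u → dec-true (w ≺? v) (≺-trans (does-true⇒ (w ≺? u) w≺u) u≺v)) u
      (dec-false (u ≺? u) (tri⇒irr compare refl)) (dec-true (u ≺? v) u≺v)

    position : Fin m → Fin m
    position u = fromℕ< (rank<size u)

    position-mono : ∀ {u v} → u ≺ v → position u < position v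
    position-mono {u} {v} u≺v = subst₂ ℕ._<_ (sym (toℕ-fromℕ< (rank<size u))) (sym (toℕ-fromℕ< (rank<size v))) (rank-mono u≺v)

    position<⇒≺ : ∀ {u v} → position u < position v → u ≺ v
    position<⇒≺ {u} {v} pu<pv with compare u v
    ... | tri< u≺v _ _ = u≺v
    ... | tri≈ _ refl _ = ⊥-elim (ℕ.<-irrefl refl pu<pv)
    ... | tri> _ _ v≺u = ⊥-elim (ℕ.<-asym pu<pv (position-mono v≺u))

    position-injective : Injective _≡_ _≡_ position
    position-injective {u} {v} pu≡pv with compare u v
    ... | tri< u≺v _ _ = ⊥-elim (ℕ.<-irrefl (cong toℕ pu≡pv) (position-mono u≺v))
    ... | tri≈ _ u≡v _ = u≡v
    ... | tri> _ _ v≺u = ⊥-elim (ℕ.<-irrefl (cong toℕ (sym pu≡pv)) (position-mono v≺u))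

    ranking : Fin m ↔ Fin m
    ranking = mk↔ₛ′ atPosition position
      (λ u → position-injective (proj₂ (injective⇒surjective position-injective (position u))))
      (λ j → proj₂ (injective⇒surjective position-injective j))
      where
      atPosition : Fin m → Fin m
      atPosition j = proj₁ (injective⇒surjective position-injective j)

    position<⇔≺ : ∀ u v → position u < position v ⇔ u ≺ v
    position<⇔≺ u v = mk⇔ position<⇒≺ position-mono

module OutRoundCriterion where

  open import Data.Bool using (Bool; true; false; _∨_)
  open import Data.Fin using (Fin; toℕ; fromℕ<; _≟_)
  open import Data.Fin.Properties using (toℕ<n; toℕ-fromℕ<; toℕ-injective)
  open import Data.Nat using (suc; _≤_; _<_; s≤s; s≤s⁻¹)
  open import Data.Nat.Properties using (≤-<-trans)
  open import Data.Product using (_,_)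
  open import Data.Sum using (_⊎_; inj₁; inj₂)
  open import Function using (_∘_; _↔_; Inverse; mk↔ₛ′)
  open import Function.Bundles using (_⇔_; mk⇔; Equivalence)
  open import Function.Properties.Equivalence using () renaming (trans to ⇔-trans; sym to ⇔-sym)
  open import Relation.Binary.PropositionalEquality
  open import Relation.Nullary using (does; yes; no)
  open Counting
  open CyclicOffset

  closedOut : ∀ {m} → (Fin m → Fin m → Bool) → Fin m → Fin m → Bool
  closedOut D u w = does (w ≟ u) ∨ D u w

  closedOut⇔ : ∀ {m} (D : Fin m → Fin m → Bool) u w → closedOut D u w ≡ true ⇔ (w ≡ u ⊎ D u w ≡ true)
  closedOut⇔ D u w with w ≟ u
  ... | yes w≡u = mk⇔ (λ _ → inj₁ w≡u) (λ _ → refl)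
  ... | no w≢u = ⇔-sym (¬A⇒A⊎B⇔B w≢u)

  InCir⇔offset≤ : ∀ {m} (σ : Fin m ↔ Fin m) i w {r} → r < m →
                  InCir (Inverse.to σ) i r w ⇔ offset i (Inverse.from σ w) ≤ r
  InCir⇔offset≤ {m} σ i w r<m = mk⇔ from-cir to-cir
    where
    open Inverse σ
    from-cir : InCir to i _ w → offset i (from w) ≤ _
    from-cir (c , c≤r , w≡) = subst (_≤ _) (sym (trans (cong (offset i ∘ from) w≡)
      (trans (cong (offset i) (strictlyInverseʳ (shift i c))) (offset-shift i c (≤-<-trans c≤r r<m))))) c≤r
    to-cir : offset i (from w) ≤ _ → InCir to i _ w
    to-cir c≤r = offset i (from w) , c≤r , sym (trans (cong to (shift-offset i (from w))) (strictlyInverseˡ w))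

  rotate : ∀ {m} → Fin m ↔ Fin m → Fin m → Fin m ↔ Fin m
  rotate σ i = mk↔ₛ′ (λ k → to (shift i (toℕ k))) (λ w → fromℕ< (offset<size i (from w))) rotate∘unrotate unrotate∘rotate
    where
    open Inverse σ
    rotate∘unrotate : ∀ w → to (shift i (toℕ (fromℕ< (offset<size i (from w))))) ≡ w
    rotate∘unrotate w rewrite toℕ-fromℕ< (offset<size i (from w)) | shift-offset i (from w) = strictlyInverseˡ w
    unrotate∘rotate : ∀ k → fromℕ< (offset<size i (from (to (shift i (toℕ k))))) ≡ k
    unrotate∘rotate k = toℕ-injective (begin
        toℕ (fromℕ< (offset<size i (from (to (shift i (toℕ k))))))  ≡⟨ toℕ-fromℕ< _ ⟩
        offset i (from (to (shift i (toℕ k))))                     ≡⟨ cong (offset i) (strictlyInverseʳ (shift i (toℕ k))) ⟩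
        offset i (shift i (toℕ k))                                 ≡⟨ offset-shift i (toℕ k) (toℕ<n k) ⟩
        toℕ k                                                      ∎)
      where open ≡-Reasoning

  closedOutAlong : ∀ {m} → (Fin m → Fin m → Bool) → Fin m ↔ Fin m → Fin m → Fin m → Bool
  closedOutAlong D σ i k = closedOut D (to i) (to (shift i (toℕ k)))
    where open Inverse σ

  module _ {m} (D : Fin m → Fin m → Bool) (σ : Fin m ↔ Fin m) (loopless : ∀ v → D v v ≡ false) where

    open Inverse σ using (to; from; strictlyInverseˡ; strictlyInverseʳ)

    count-closedOutAlong : ∀ i → count (closedOutAlong D σ i) ≡ suc (outdeg D (to i))
    count-closedOutAlong i = begin
        count (closedOutAlong D σ i)   ≡⟨ count-permute (closedOut D (to i)) (rotate σ i) ⟨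
        count (closedOut D (to i))     ≡⟨ count-insert (D (to i)) (to i) (loopless (to i)) ⟩
        suc (count (D (to i)))         ≡⟨ cong suc (outdeg≡count D (to i)) ⟨
        suc (outdeg D (to i))          ∎
      where open ≡-Reasoning

    outRound-criterion : (∀ i → DownClosed (closedOutAlong D σ i)) → IsOutRound D
    outRound-criterion closed = σ , λ i w →
      ⇔-trans (⇔-sym (closedOut⇔ D (to i) w)) (⇔-trans (closed⇔offset≤ i w)
        (⇔-sym (InCir⇔offset≤ σ i w (outdeg<size D (to i) (loopless (to i))))))
      where
      closed⇔offset≤ : ∀ i w → closedOut D (to i) w ≡ true ⇔ offset i (from w) ≤ outdeg D (to i)
      closed⇔offset≤ i w = subst (λ w′ → closedOut D (to i) w′ ≡ true ⇔ c ≤ outdeg D (to i)) landed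
        (subst (λ c′ → closedOutAlong D σ i k ≡ true ⇔ c′ ≤ outdeg D (to i)) (toℕ-fromℕ< c<m)
          (⇔-trans (downClosed⇒initialSegment (closed i) k) (≡⇒<-suc-⇔ (count-closedOutAlong i))))
        where
        c = offset i (from w)
        c<m = offset<size i (from w)
        k = fromℕ< c<m
        landed : to (shift i (toℕ k)) ≡ w
        landed = trans (cong (to ∘ shift i) (toℕ-fromℕ< c<m)) (trans (cong to (shift-offset i (from w))) (strictlyInverseˡ w))
        ≡⇒<-suc-⇔ : ∀ {a b c} → b ≡ suc c → (a < b) ⇔ (a ≤ c)
        ≡⇒<-suc-⇔ refl = mk⇔ s≤s⁻¹ s≤s

module ArcsToOutRound {m} (arc : Fin m → OpenArc) (nonCovering : ∀ u v → u ≢ v → ¬ Cover (arc u) (arc v)) where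

  open import Data.Bool using (Bool; true; false)
  open import Data.Empty using (⊥-elim)
  open import Data.Fin using (Fin; toℕ)
  open import Data.Fin.Properties using (toℕ-injective; toℕ<n)
  import Data.Nat as ℕ
  import Data.Nat.Properties as ℕ
  open import Data.Product using (_×_; _,_)
  open import Data.Rational
  open import Data.Rational.Properties
  open import Data.Sum using (_⊎_; inj₁; inj₂)
  import Data.Sum as Sum
  open import Function using (_∘_; Inverse)
  open import Function.Bundles using (_⇔_; mk⇔; Equivalence)
  open import Function.Properties.Equivalence using () renaming (trans to ⇔-trans)
  open import Relation.Binary using (Transitive; Trichotomous; tri<; tri≈; tri>)
  open import Data.Product.Relation.Binary.Lex.Strict using (×-Lex; ×-transitive; ×-compare)
  open import Data.Rational.Solver using (module +-*-Solver)
  open import Relation.Binary.PropositionalEquality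
  open import Relation.Binary.PropositionalEquality.Properties using (isEquivalence)
  open import Relation.Nullary using (¬_; Dec; does; yes; no; _×-dec_; _⊎-dec_)
  open import Relation.Nullary.Decidable using (dec-true; dec-false)
  open CircularDistance
  open ArcGeometry
  open Counting using (DownClosed)
  open CyclicOffset using (offset; offset-shift)
  open OutRoundCriterion using (closedOut⇔; closedOutAlong; outRound-criterion)
  open FiniteOrder using (module Ranking)
  open Unwinding

  ℓ : Fin m → ℚ
  ℓ u = len (arc u)

  d : Fin m → Fin m → ℚ
  d u w = δ (start (arc u)) (start (arc w))

  Out : Fin m → Fin m → Set
  Out u w = d u w < ℓ u × (0ℚ < d u w ⊎ toℕ u ℕ.< toℕ w)

  Out? : ∀ u w → Dec (Out u w)
  Out? u w = (d u w <? ℓ u) ×-dec ((0ℚ <? d u w) ⊎-dec (toℕ u ℕ.<? toℕ w))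

  orientation : Fin m → Fin m → Bool
  orientation u w = does (Out? u w)

  orientation⇔Out : ∀ u w → orientation u w ≡ true ⇔ Out u w
  orientation⇔Out u w = mk⇔ (does-true⇒ (Out? u w)) (dec-true (Out? u w))

  Out-irrefl : ∀ u → ¬ Out u u
  Out-irrefl u (_ , inj₁ 0<duu) = <-irrefl (sym (δ-self (start (arc u)))) 0<duu
  Out-irrefl u (_ , inj₂ u<u) = ℕ.<-irrefl refl u<u

  Out⇒≢ : ∀ {u w} → Out u w → u ≢ w
  Out⇒≢ {u} uw refl = Out-irrefl u uw

  Out-asym : ∀ u w → Out u w → ¬ Out w u
  Out-asym u w uw@(duw<ℓ , inj₁ 0<duw) (dwu<ℓ , _) =
    nonCovering u w (Out⇒≢ uw) (cover⇐ (arc u) (arc w) 0<duw duw<ℓ dwu<ℓ)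
  Out-asym u w uw@(duw<ℓ , inj₂ _) (dwu<ℓ , inj₁ 0<dwu) =
    nonCovering w u (Out⇒≢ uw ∘ sym) (cover⇐ (arc w) (arc u) 0<dwu dwu<ℓ duw<ℓ)
  Out-asym u w (_ , inj₂ u<w) (_ , inj₂ w<u) = ℕ.<-asym u<w w<u

  Out⇒Meet : ∀ u w → Out u w → Meet (arc u) (arc w)
  Out⇒Meet u w (duw<ℓ , _) = meet⇐ (arc u) (arc w) duw<ℓ

  Meet⇒Out : ∀ u w → u ≢ w → Meet (arc u) (arc w) → Out u w ⊎ Out w u
  Meet⇒Out u w u≢w meet =
    Sum.[ from-start u w u≢w , Sum.swap ∘ from-start w u (u≢w ∘ sym) ]′ (meet⇒ (arc u) (arc w) meet)
    where
    from-start : ∀ u w → u ≢ w → d u w < ℓ u → Out u w ⊎ Out w u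
    from-start u w u≢w duw<ℓ = by-distance (0ℚ <? d u w)
      where
      by-distance : Dec (0ℚ < d u w) → Out u w ⊎ Out w u
      by-distance (yes 0<duw) = inj₁ (duw<ℓ , inj₁ 0<duw)
      by-distance (no 0≮duw) with ℕ.<-cmp (toℕ u) (toℕ w)
      ... | tri< u<w _ _ = inj₁ (duw<ℓ , inj₂ u<w)
      ... | tri≈ _ u≡w _ = ⊥-elim (u≢w (toℕ-injective u≡w))
      ... | tri> _ _ w<u = inj₂ (subst (_< ℓ w) (sym dwu≡0) (len>0 (arc w)) , inj₂ w<u)
        where
        dwu≡0 : d w u ≡ 0ℚ
        dwu≡0 = δ-reverse-0 (start (arc u)) (start (arc w))
          (≤-antisym (≮⇒≥ 0≮duw) (δ-nonneg (start (arc u)) (start (arc w))))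

  startPoint : Fin m → ℚ
  startPoint u = δ 0ℚ (start (arc u))

  startPoint-nonneg : ∀ u → 0ℚ ≤ startPoint u
  startPoint-nonneg u = δ-nonneg 0ℚ (start (arc u))

  startPoint<1 : ∀ u → startPoint u < 1ℚ
  startPoint<1 u = δ<1 0ℚ (start (arc u))

  _≺_ : Fin m → Fin m → Set
  u ≺ w = ×-Lex _≡_ _<_ ℕ._<_ (startPoint u , toℕ u) (startPoint w , toℕ w)

  ≺-trans : Transitive _≺_
  ≺-trans {u} {v} {w} = ×-transitive {_≈₁_ = _≡_} {_<₁_ = _<_} {_<₂_ = ℕ._<_} isEquivalence (resp₂ _<_) <-trans ℕ.<-trans
    {startPoint u , toℕ u} {startPoint v , toℕ v} {startPoint w , toℕ w}

  ≺-compare : Trichotomous _≡_ _≺_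
  ≺-compare u w with ×-compare sym <-cmp ℕ.<-cmp (startPoint u , toℕ u) (startPoint w , toℕ w)
  ... | tri< u≺w u≉w w⊀u = tri< u≺w (λ { refl → u≉w (refl , refl) }) w⊀u
  ... | tri≈ u⊀w (_ , u≡w) w⊀u = tri≈ u⊀w (toℕ-injective u≡w) w⊀u
  ... | tri> u⊀w u≉w w≺u = tri> u⊀w (λ { refl → u≉w (refl , refl) }) w≺u

  ≺⇒startPoint≤ : ∀ {u w} → u ≺ w → startPoint u ≤ startPoint w
  ≺⇒startPoint≤ (inj₁ ku<kw) = <⇒≤ ku<kw
  ≺⇒startPoint≤ (inj₂ (ku≡kw , _)) = ≤-reflexive ku≡kw

  d-ahead : ∀ u w → startPoint u ≤ startPoint w → d u w ≡ startPoint w - startPoint u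
  d-ahead u w su≤sw = Sum.[ unwrap , (λ sw≡ → ⊥-elim (<⇒≱ (subst (_< su) (sym sw≡) wrapped<) su≤sw)) ]′
    (δ-+ 0ℚ (start (arc u)) (start (arc w)))
    where
    open +-*-Solver
    su = startPoint u
    unwrap : startPoint w ≡ su + d u w → d u w ≡ startPoint w - su
    unwrap sw≡ = trans (solve 2 (λ s e → e := s :+ e :- s) refl su (d u w)) (cong (_- su) (sym sw≡))
    wrapped< : su + d u w - 1ℚ < su
    wrapped< = subst (su + d u w - 1ℚ <_) (solve 1 (λ s → s :+ con 1ℚ :- con 1ℚ := s) refl su)
      (+-monoˡ-< (- 1ℚ) (+-monoʳ-< su (δ<1 (start (arc u)) (start (arc w)))))

  d-behind : ∀ u w → startPoint w < startPoint u → d u w ≡ startPoint w + 1ℚ - startPoint u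
  d-behind u w sw<su = Sum.[ (λ sw≡ → ⊥-elim (<⇒≱ sw<su (subst (su ≤_) (sym sw≡) unwrapped≥))) , unwrap ]′
    (δ-+ 0ℚ (start (arc u)) (start (arc w)))
    where
    open +-*-Solver
    su = startPoint u
    unwrap : startPoint w ≡ su + d u w - 1ℚ → d u w ≡ startPoint w + 1ℚ - su
    unwrap sw≡ = trans (solve 2 (λ s e → e := s :+ e :- con 1ℚ :+ con 1ℚ :- s) refl su (d u w))
      (cong (λ x → x + 1ℚ - su) (sym sw≡))
    unwrapped≥ : su ≤ su + d u w
    unwrapped≥ = subst (_≤ su + d u w) (+-identityʳ su) (+-monoʳ-≤ su (δ-nonneg (start (arc u)) (start (arc w))))

  Out-ahead : ∀ {u w} → u ≺ w → Out u w ⇔ startPoint w - startPoint u < ℓ u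
  Out-ahead {u} {w} u≺w = mk⇔ leave enter
    where
    d≡ : d u w ≡ startPoint w - startPoint u
    d≡ = d-ahead u w (≺⇒startPoint≤ u≺w)
    leave : Out u w → startPoint w - startPoint u < ℓ u
    leave (duw<ℓ , _) = subst (_< ℓ u) d≡ duw<ℓ
    ahead : u ≺ w → 0ℚ < d u w ⊎ toℕ u ℕ.< toℕ w
    ahead (inj₁ ku<kw) = inj₁ (subst (0ℚ <_) (sym d≡) (<⇒0<- ku<kw))
    ahead (inj₂ (_ , u<w)) = inj₂ u<w
    enter : startPoint w - startPoint u < ℓ u → Out u w
    enter θ<ℓ = subst (_< ℓ u) (sym d≡) θ<ℓ , ahead u≺w

  startPoint<startPoint+1 : ∀ u w → startPoint u < startPoint w + 1ℚ
  startPoint<startPoint+1 u w =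
    <-≤-trans (startPoint<1 u) (subst (_≤ startPoint w + 1ℚ) (+-identityˡ 1ℚ) (+-monoˡ-≤ 1ℚ (startPoint-nonneg w)))

  Out-behind : ∀ {u w} → w ≺ u → Out u w ⇔ startPoint w + 1ℚ - startPoint u < ℓ u
  Out-behind {u} {w} (inj₁ kw<ku) = mk⇔ leave enter
    where
    d≡ : d u w ≡ startPoint w + 1ℚ - startPoint u
    d≡ = d-behind u w kw<ku
    leave : Out u w → startPoint w + 1ℚ - startPoint u < ℓ u
    leave (duw<ℓ , _) = subst (_< ℓ u) d≡ duw<ℓ
    enter : startPoint w + 1ℚ - startPoint u < ℓ u → Out u w
    enter θ<ℓ = subst (_< ℓ u) (sym d≡) θ<ℓ , inj₁ (subst (0ℚ <_) (sym d≡) (<⇒0<- (startPoint<startPoint+1 u w)))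
  Out-behind {u} {w} (inj₂ (kw≡ku , w<u)) = mk⇔ leave enter
    where
    open +-*-Solver
    θ≡1 : startPoint w + 1ℚ - startPoint u ≡ 1ℚ
    θ≡1 = trans (cong (λ k → k + 1ℚ - startPoint u) kw≡ku) (solve 1 (λ k → k :+ con 1ℚ :- k := con 1ℚ) refl (startPoint u))
    d≡0 : d u w ≡ 0ℚ
    d≡0 = trans (d-ahead u w (≤-reflexive (sym kw≡ku))) (trans (cong (_- startPoint u) kw≡ku) (+-inverseʳ (startPoint u)))
    leave : Out u w → startPoint w + 1ℚ - startPoint u < ℓ u
    leave (_ , inj₁ 0<duw) = ⊥-elim (<-irrefl (sym d≡0) 0<duw)
    leave (_ , inj₂ u<w) = ⊥-elim (ℕ.<-asym u<w w<u)
    enter : startPoint w + 1ℚ - startPoint u < ℓ u → Out u w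
    enter θ<ℓ = ⊥-elim (<-irrefl refl (<-≤-trans θ<ℓ (subst (ℓ u ≤_) (sym θ≡1) (len≤1 (arc u)))))

  open Ranking ≺-trans ≺-compare using (ranking; position<⇔≺)
  open Inverse ranking using (to; from; strictlyInverseʳ)

  g : Fin m → ℚ
  g j = startPoint (to j)

  to-≺ : ∀ {i j} → toℕ i ℕ.< toℕ j → to i ≺ to j
  to-≺ {i} {j} i<j = Equivalence.to (position<⇔≺ (to i) (to j))
    (subst₂ (λ x y → toℕ x ℕ.< toℕ y) (sym (strictlyInverseʳ i)) (sym (strictlyInverseʳ j)) i<j)

  g-mono : ∀ {j j′} → toℕ j ℕ.≤ toℕ j′ → g j ≤ g j′
  g-mono {j} {j′} j≤j′ =
    Sum.[ ≺⇒startPoint≤ ∘ to-≺ , ≤-reflexive ∘ cong g ∘ toℕ-injective ]′ (ℕ.m≤n⇒m<n∨m≡n j≤j′)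

  to-injective : ∀ {i j} → to i ≡ to j → i ≡ j
  to-injective {i} {j} ti≡tj = trans (sym (strictlyInverseʳ i)) (trans (cong from ti≡tj) (strictlyInverseʳ j))

  ClosedOutAt : Fin m → Fin m → Set
  ClosedOutAt i j = to j ≡ to i ⊎ Out (to i) (to j)

  <-resp-≡-⇔ : ∀ {x y z} → x ≡ y → (x < z) ⇔ (y < z)
  <-resp-≡-⇔ x≡y = mk⇔ (subst (_< _) x≡y) (subst (_< _) (sym x≡y))

  threshold : ∀ i j → ClosedOutAt i j ⇔ unwound g i j - g i < ℓ (to i)
  threshold i j = by-position (unwound-cases g i j)
    where
    θ = unwound g i j - g i
    elsewhere : toℕ i ≢ toℕ j → ¬ to j ≡ to i
    elsewhere i≢j tj≡ti = i≢j (cong toℕ (to-injective (sym tj≡ti)))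
    by-position : (unwound g i j ≡ g j × toℕ i ℕ.≤ toℕ j) ⊎ (unwound g i j ≡ g j + 1ℚ × toℕ j ℕ.< toℕ i) →
                  ClosedOutAt i j ⇔ θ < ℓ (to i)
    by-position (inj₁ (unwound≡ , i≤j)) = Sum.[ ahead , itself ]′ (ℕ.m≤n⇒m<n∨m≡n i≤j)
      where
      θ≡ : θ ≡ g j - g i
      θ≡ = cong (_- g i) unwound≡
      ahead : toℕ i ℕ.< toℕ j → ClosedOutAt i j ⇔ θ < ℓ (to i)
      ahead i<j = ⇔-trans (¬A⇒A⊎B⇔B (elsewhere (ℕ.<⇒≢ i<j)))
        (⇔-trans (Out-ahead (to-≺ i<j)) (<-resp-≡-⇔ (sym θ≡)))
      itself : toℕ i ≡ toℕ j → ClosedOutAt i j ⇔ θ < ℓ (to i)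
      itself i≡j = mk⇔ (λ _ → subst (_< ℓ (to i)) (sym θ≡0) (len>0 (arc (to i))))
                       (λ _ → inj₁ (cong to (sym (toℕ-injective i≡j))))
        where
        θ≡0 : θ ≡ 0ℚ
        θ≡0 = trans θ≡ (trans (cong (λ x → g x - g i) (sym (toℕ-injective i≡j))) (+-inverseʳ (g i)))
    by-position (inj₂ (unwound≡ , j<i)) =
      ⇔-trans (¬A⇒A⊎B⇔B (elsewhere (ℕ.>⇒≢ j<i)))
        (⇔-trans (Out-behind (to-≺ j<i)) (<-resp-≡-⇔ (sym (cong (_- g i) unwound≡))))

  loopless : ∀ v → orientation v v ≡ false
  loopless v = dec-false (Out? v v) (Out-irrefl v)

  closedOutAlong⇔ : ∀ i k → closedOutAlong orientation ranking i k ≡ true ⇔ ClosedOutAt i (shift i (toℕ k))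
  closedOutAlong⇔ i k = ⇔-trans (closedOut⇔ orientation (to i) w)
    (mk⇔ (Sum.map₂ (Equivalence.to (orientation⇔Out (to i) w))) (Sum.map₂ (Equivalence.from (orientation⇔Out (to i) w))))
    where w = to (shift i (toℕ k))

  closedOutAlong-downClosed : ∀ i → DownClosed (closedOutAlong orientation ranking i)
  closedOutAlong-downClosed i {k′} {k} k′≤k seen =
    Equivalence.from (closedOutAlong⇔ i k′) (Equivalence.from (threshold i j′) (begin-strict
      unwound g i j′ - g i   ≤⟨ +-monoˡ-≤ (- g i) (unwound-mono g g-mono (startPoint-nonneg ∘ to) (startPoint<1 ∘ to) i offsets≤) ⟩
      unwound g i j - g i    <⟨ Equivalence.to (threshold i j) (Equivalence.to (closedOutAlong⇔ i k) seen) ⟩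
      ℓ (to i)               ∎))
    where
    open ≤-Reasoning
    j = shift i (toℕ k)
    j′ = shift i (toℕ k′)
    offsets≤ : offset i j′ ℕ.≤ offset i j
    offsets≤ = subst₂ ℕ._≤_ (sym (offset-shift i (toℕ k′) (toℕ<n k′))) (sym (offset-shift i (toℕ k) (toℕ<n k))) k′≤k

  outRound : IsOutRound orientation
  outRound = outRound-criterion orientation ranking loopless closedOutAlong-downClosed

module OutRoundToArcs {k} (D : Fin (suc k) → Fin (suc k) → Bool) (loopless : ∀ v → D v v ≡ false)
         (antisymmetric : ∀ u v → ¬ (D u v ≡ true × D v u ≡ true)) (isOutRound : IsOutRound D) where

  open import Data.Bool using (Bool; true; false)
  open import Data.Fin using (Fin; toℕ)
  open import Data.Integer as ℤ using (ℤ; 0ℤ; -1ℤ)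
  import Data.Integer.Properties as ℤ
  open import Data.Integer.Solver using (module +-*-Solver)
  open import Data.Nat as ℕ using (ℕ; suc; s≤s)
  import Data.Nat.Properties as ℕ
  open import Data.Product using (_×_; _,_; proj₁; proj₂)
  open import Data.Rational using (_/_; _<_; _≤_)
  open import Data.Rational.Properties using (0/n≡0)
  open import Data.Sum using (_⊎_; inj₁; inj₂)
  import Data.Sum as Sum
  open import Function using (_∘_; Inverse)
  open import Function.Bundles using (_⇔_; mk⇔; Equivalence)
  open import Function.Properties.Equivalence using () renaming (trans to ⇔-trans; sym to ⇔-sym)
  open import Relation.Binary.PropositionalEquality
  open import Relation.Nullary using (¬_)
  open Fractions
  open CircularDistance
  open ArcGeometry
  open Counting using (outdeg<size)
  open CyclicOffset
  open OutRoundCriterion using (InCir⇔offset≤)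

  private
    m = suc k
    -- the common denominator 2m
    N = k ℕ.+ suc k
    σ = proj₁ isOutRound
    open Inverse σ using (to; from; strictlyInverseˡ)

  position : Fin m → ℕ
  position v = toℕ (from v)

  r : Fin m → ℕ
  r v = outdeg D v

  r<size : ∀ v → r v ℕ.< m
  r<size v = outdeg<size D v (loopless v)

  -- vertex v sits at 2·position/2m, and its arc covers r v + ½ steps of 1/m
  arc : Fin m → OpenArc
  arc v = record
    { start = ℤ.+ (position v ℕ.+ position v) / suc N
    ; len   = ℓ
    ; len>0 = subst (_< ℓ) (0/n≡0 (suc N)) (/-mono-< N {0ℤ} (ℤ.+<+ (ℕ.<-≤-trans ℕ.z<s (ℕ.m≤n+m (suc (r v)) (r v)))))
    ; len≤1 = subst (ℓ ≤_) (n/n≡1 N) (/-mono-≤ N (ℤ.+≤+ (ℕ.+-mono-≤ (ℕ.<⇒≤ (r<size v)) (r<size v))))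
    }
    where
    ℓ = ℤ.+ (r v ℕ.+ suc (r v)) / suc N

  private
    doubled : ∀ {a b c e} → a ℕ.+ c ≡ b ℕ.+ e →
              ℤ.+ (b ℕ.+ b) ℤ.- ℤ.+ (a ℕ.+ a) ≡ ℤ.+ (c ℕ.+ c) ℤ.- ℤ.+ (e ℕ.+ e)
    doubled {a} {b} {c} {e} a+c≡b+e = begin
      ℤ.+ (b ℕ.+ b) ℤ.- ℤ.+ (a ℕ.+ a)
        ≡⟨ cong₂ ℤ._-_ (ℤ.pos-+ b b) (ℤ.pos-+ a a) ⟩
      (B ℤ.+ B) ℤ.- (A ℤ.+ A)
        ≡⟨ solve 4 (λ A B C E → (B :+ B) :- (A :+ A)
                             := (C :+ C) :- (E :+ E) :+ ((B :+ E) :- (A :+ C)) :+ ((B :+ E) :- (A :+ C))) refl A B C E ⟩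
      (C ℤ.+ C) ℤ.- (E ℤ.+ E) ℤ.+ ((B ℤ.+ E) ℤ.- (A ℤ.+ C)) ℤ.+ ((B ℤ.+ E) ℤ.- (A ℤ.+ C))
        ≡⟨ cong (λ x → (C ℤ.+ C) ℤ.- (E ℤ.+ E) ℤ.+ ((B ℤ.+ E) ℤ.- x) ℤ.+ ((B ℤ.+ E) ℤ.- x)) A+C≡B+E ⟩
      (C ℤ.+ C) ℤ.- (E ℤ.+ E) ℤ.+ ((B ℤ.+ E) ℤ.- (B ℤ.+ E)) ℤ.+ ((B ℤ.+ E) ℤ.- (B ℤ.+ E))
        ≡⟨ solve 3 (λ C E X → (C :+ C) :- (E :+ E) :+ (X :- X) :+ (X :- X) := (C :+ C) :- (E :+ E)) refl C E (B ℤ.+ E) ⟩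
      (C ℤ.+ C) ℤ.- (E ℤ.+ E)
        ≡⟨ cong₂ ℤ._-_ (ℤ.pos-+ c c) (ℤ.pos-+ e e) ⟨
      ℤ.+ (c ℕ.+ c) ℤ.- ℤ.+ (e ℕ.+ e) ∎
      where
      open ≡-Reasoning
      open +-*-Solver
      A = ℤ.+ a
      B = ℤ.+ b
      C = ℤ.+ c
      E = ℤ.+ e
      A+C≡B+E : A ℤ.+ C ≡ B ℤ.+ E
      A+C≡B+E = trans (sym (ℤ.pos-+ a c)) (trans (cong ℤ.+_ a+c≡b+e) (ℤ.pos-+ b e))

  steps : Fin m → Fin m → ℕ
  steps v w = offset (from v) (from w)

  δ-starts : ∀ v w → δ (start (arc v)) (start (arc w)) ≡ ℤ.+ (steps v w ℕ.+ steps v w) / suc N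
  δ-starts v w = by-lap (offset-lands (from v) (from w))
    where
    open +-*-Solver
    c = steps v w
    2p : Fin m → ℤ
    2p u = ℤ.+ (position u ℕ.+ position u)
    c+c<2m : c ℕ.+ c ℕ.< suc N
    c+c<2m = ℕ.+-mono-< (offset<size (from v) (from w)) (offset<size (from v) (from w))
    by-lap : Lands (from v) c (from w) → δ (start (arc v)) (start (arc w)) ≡ ℤ.+ (c ℕ.+ c) / suc N
    by-lap (inj₁ e) = δ-grid N {2p v} {2p w} 0ℤ c+c<2m
      (trans (doubled {position v} {position w} {c} {0} (trans e (sym (ℕ.+-identityʳ (position w)))))
        (solve 1 (λ C → C :- con 0ℤ := C :+ con 0ℤ :* con (ℤ.+ suc N)) refl (ℤ.+ (c ℕ.+ c))))
    by-lap (inj₂ e) = δ-grid N {2p v} {2p w} -1ℤ c+c<2m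
      (trans (doubled {position v} {position w} {c} {m} e)
        (solve 2 (λ C M → C :- M := C :+ con -1ℤ :* M) refl (ℤ.+ (c ℕ.+ c)) (ℤ.+ suc N)))

  private
    double<odd⇔≤ : ∀ c r → c ℕ.+ c ℕ.< r ℕ.+ suc r ⇔ c ℕ.≤ r
    double<odd⇔≤ c r = mk⇔
      (λ c+c<r+1+r → ℕ.≮⇒≥ (λ r<c → ℕ.<⇒≱ c+c<r+1+r (ℕ.+-mono-≤ (ℕ.<⇒≤ r<c) r<c)))
      (λ c≤r → ℕ.+-mono-≤-< c≤r (s≤s c≤r))

  steps≤⇔δ< : ∀ v w → steps v w ℕ.≤ r v ⇔ δ (start (arc v)) (start (arc w)) < len (arc v)
  steps≤⇔δ< v w = ⇔-trans (⇔-sym (double<odd⇔≤ c (r v)))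
    (mk⇔ (λ lt → subst (_< len (arc v)) (sym (δ-starts v w)) (/-mono-< N (ℤ.+<+ lt)))
         (λ lt → ℤ.drop‿+<+ (/-cancel-< N (subst (_< len (arc v)) (δ-starts v w) lt))))
    where c = steps v w

  closedOut⇔δ< : ∀ v w → (w ≡ v ⊎ D v w ≡ true) ⇔ δ (start (arc v)) (start (arc w)) < len (arc v)
  closedOut⇔δ< v w = ⇔-trans round (⇔-trans (InCir⇔offset≤ σ (from v) w (r<size v)) (steps≤⇔δ< v w))
    where
    round : (w ≡ v ⊎ D v w ≡ true) ⇔ InCir to (from v) (r v) w
    round = subst (λ u → (w ≡ u ⊎ D u w ≡ true) ⇔ InCir to (from v) (outdeg D u) w) (strictlyInverseˡ v)
      (proj₂ isOutRound (from v) w)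

  Out⇔δ< : ∀ v w → v ≢ w → D v w ≡ true ⇔ δ (start (arc v)) (start (arc w)) < len (arc v)
  Out⇔δ< v w v≢w = ⇔-trans (⇔-sym (¬A⇒A⊎B⇔B (v≢w ∘ sym))) (closedOut⇔δ< v w)

  nonCovering : ∀ u v → u ≢ v → ¬ Cover (arc u) (arc v)
  nonCovering u v u≢v cover = antisymmetric u v (oriented u v u≢v cover , oriented v u (u≢v ∘ sym) (Sum.swap ∘ cover))
    where
    oriented : ∀ u v → u ≢ v → Cover (arc u) (arc v) → D u v ≡ true
    oriented u v u≢v cover = Equivalence.from (Out⇔δ< u v u≢v)
      (proj₂ (∈Arc⇒ (start (arc v)) (arc u) (cover⇒start∈ (arc u) (arc v) cover)))

  Out⇔Meet : ∀ u v → u ≢ v → (D u v ≡ true ⊎ D v u ≡ true) ⇔ Meet (arc u) (arc v)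
  Out⇔Meet u v u≢v = mk⇔
    Sum.[ meet⇐ (arc u) (arc v) ∘ Equivalence.to (Out⇔δ< u v u≢v)
        , Meet-sym (arc v) (arc u) ∘ meet⇐ (arc v) (arc u) ∘ Equivalence.to (Out⇔δ< v u (u≢v ∘ sym)) ]′
    (Sum.map (Equivalence.from (Out⇔δ< u v u≢v)) (Equivalence.from (Out⇔δ< v u (u≢v ∘ sym))) ∘ meet⇒ (arc u) (arc v))

arcs⇒outRoundOrientation : (G : Graph) → IsNormalCircularArc G → HasOutRoundOrientation G
arcs⇒outRoundOrientation G (arc , nonCovering , adj⇔meet) =
  orientation , (oriented⇒adjacent , adjacent⇒oriented , antisymmetric) , outRound
  where
  open ArcsToOutRound arc nonCovering
  oriented⇒adjacent : ∀ u v → orientation u v ≡ true → adj G u v ≡ true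
  oriented⇒adjacent u v uv = Equivalence.from (adj⇔meet u v (Out⇒≢ Out-uv)) (Out⇒Meet u v Out-uv)
    where Out-uv = Equivalence.to (orientation⇔Out u v) uv
  adjacent⇒oriented : ∀ u v → adj G u v ≡ true → orientation u v ≡ true ⊎ orientation v u ≡ true
  adjacent⇒oriented u v uv = Sum.map (dec-true (Out? u v)) (dec-true (Out? v u))
    (Meet⇒Out u v u≢v (Equivalence.to (adj⇔meet u v u≢v) uv))
    where
    u≢v : u ≢ v
    u≢v refl = case trans (sym uv) (irrefl G u) of λ ()
  antisymmetric : ∀ u v → ¬ (orientation u v ≡ true × orientation v u ≡ true)
  antisymmetric u v (uv , vu) = Out-asym u v (Equivalence.to (orientation⇔Out u v) uv) (Equivalence.to (orientation⇔Out v u) vu)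

outRoundOrientation⇒arcs : (G : Graph) → HasOutRoundOrientation G → IsNormalCircularArc G
outRoundOrientation⇒arcs record { n = zero } _ = (λ ()) , (λ ()) , (λ ())
outRoundOrientation⇒arcs G@record { n = suc _ } (D , (oriented⇒adjacent , adjacent⇒oriented , antisymmetric) , isOutRound) =
  arc , nonCovering , adj⇔meet
  where
  loopless : ∀ v → D v v ≡ false
  loopless v with D v v in vv
  ... | false = refl
  ... | true = trans (sym (oriented⇒adjacent v v vv)) (irrefl G v)
  open OutRoundToArcs D loopless antisymmetric isOutRound
  adj⇔meet : ∀ u v → u ≢ v → adj G u v ≡ true ⇔ Meet (arc u) (arc v)
  adj⇔meet u v u≢v = ⇔-trans
    (mk⇔ (adjacent⇒oriented u v) Sum.[ oriented⇒adjacent u v , (λ vu → trans (symm G u v) (oriented⇒adjacent v u vu)) ]′)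
    (Out⇔Meet u v u≢v)

mainTheorem9 : (G : Graph) → IsNormalCircularArc G ⇔ HasOutRoundOrientation G
mainTheorem9 G = mk⇔ (arcs⇒outRoundOrientation G) (outRoundOrientation⇒arcs G)
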